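{- For every extraTrib $(S_i)_{i\in\mathbb Z}$ there exist an index $k$ and a row $r$ of the Trithoff array such that $S_{k+j-1}=T_{r,j}$ for all $j\ge1$; that is, a tail of every extraTrib is a row of the Trithoff array.
   Context: An extraTrib is a two-sided integer sequence $(S_i)_{i\in\mathbb Z}$ with $S_i=S_{i-1}+S_{i-2}+S_{i-3}$ for all $i$ and $S_i>0$ for all sufficiently large $i$. Tribonacci numbers: $T_0=0,T_1=0,T_2=1$, $T_n=T_{n-1}+T_{n-2}+T_{n-3}$. Every $N\ge0$ has a unique canonical Tribonacci representation $N=\sum_i d_iT_{i+3}$ with $d_i\in\{0,1\}$, no three consecutive $1$s; $\operatorname{out}(N)=\sum_i d_iT_{i+4}$. Trithoff array: $T_{r,1}$ is the $r$-th smallest positive integer whose canonical representation has $d_0=1$, and $T_{r,c+1}=\operatorname{out}(T_{r,c})$ for $c\ge1$. -}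

module Defs where

open import Data.Nat using (ℕ; zero; suc; _+_; _<_; _≤_)
open import Data.Integer as ℤ using (ℤ; +_; -[1+_]; 0ℤ; 1ℤ)
open import Data.Bool using (Bool; true; false)
open import Data.List using (List; []; _∷_; length)
open import Data.List.Membership.Propositional using (_∈_)
open import Data.List.Relation.Unary.Unique.Propositional using (Unique)
open import Data.List.Relation.Unary.All using (All)
open import Data.Product using (Σ; ∃; _×_; _,_)
open import Relation.Binary.PropositionalEquality using (_≡_)

T : ℕ → ℕ
T 0 = 0
T 1 = 0
T 2 = 1
T (suc (suc (suc n))) = T (suc (suc n)) + T (suc n) + T n

IsExtraTrib : (ℤ → ℤ) → Set
IsExtraTrib S =
  (∀ i → S i ≡ S (i ℤ.- 1ℤ) ℤ.+ S (i ℤ.- + 2) ℤ.+ S (i ℤ.- + 3))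
  × (∃ λ i₀ → ∀ i → i₀ ℤ.≤ i → 0ℤ ℤ.< S i)

-- Digit lists, least significant first: d ∷ ds means d_0 = d, etc.
digit : Bool → ℕ → ℕ
digit true  x = x
digit false x = 0

-- value with weight T (i + s) at position i (s = 3 gives N, s = 4 gives out)
valFrom : ℕ → List Bool → ℕ
valFrom s [] = 0
valFrom s (d ∷ ds) = digit d (T s) + valFrom (suc s) ds

data NoThree : List Bool → Set where
  nt-nil  : NoThree []
  nt-cons : ∀ {d ds} → NoThree ds →
            (∀ {ds'} → ds ≡ true ∷ true ∷ ds' → d ≡ false) →
            NoThree (d ∷ ds)

CanonRep : List Bool → ℕ → Set
CanonRep ds N = NoThree ds × valFrom 3 ds ≡ N

-- out(N) = M  (relational; functional by uniqueness of canonical representation)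
Out : ℕ → ℕ → Set
Out N M = ∃ λ ds → CanonRep ds N × valFrom 4 ds ≡ M

D0One : ℕ → Set
D0One N = ∃ λ ds → CanonRep (true ∷ ds) N

-- T_{r,1} = N : N is the r-th smallest positive integer with d_0 = 1,
-- i.e. 0 < N, D0One N, and the set {m | 0 < m < N, D0One m} has exactly r - 1 elements.
FirstCol : ℕ → ℕ → Set
FirstCol r N =
  1 ≤ r × 0 < N × D0One N ×
  Σ (List ℕ) λ xs → suc (length xs) ≡ r × Unique xs
    × All (λ m → 0 < m × m < N × D0One m) xs
    × (∀ m → 0 < m → m < N → D0One m → m ∈ xs)

data Trithoff : ℕ → ℕ → ℕ → Set where
  col1 : ∀ {r N} → FirstCol r N → Trithoff r 1 N
  colS : ∀ {r c N M} → Trithoff r c N → Out N M → Trithoff r (suc c) M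

-- From some index on, an extraTrib is a nonnegative Tribonacci-like sequence, so at every
-- large level N its value is Σ cᵢ T (N - i) for one fixed coefficient list c. Rewriting c by
-- T p = T (p - 1) + T (p - 2) + T (p - 3) and 2 T p = T (p + 1) + T (p - 3) pushes weight
-- towards the head, i.e. up in the lexicographic order, without increasing Σ cᵢ; hence it
-- terminates, in a 0/1 list without three consecutive ones. Read from the least significant
-- end this is a canonical representation, and the later terms of the sequence are its shifts,
-- i.e. its images under out. Stripping the leading zeros (running the recurrence backwards)
-- gives a start with d₀ = 1, which lies in the first column of the Trithoff array.

module Submission where

open import Algebra.Bundles using (AbelianGroup)
open import Data.Bool using (Bool; true; false)
open import Data.Empty using (⊥-elim)
open import Data.Integer as ℤ using (ℤ; +_; 0ℤ; 1ℤ)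
import Data.Integer.Properties as ℤ
import Data.Integer.Tactic.RingSolver as ℤ-Solver
open import Data.List using (List; []; _∷_; _++_; length; replicate; take; drop; filter; upTo)
open import Data.Nat.ListAction using (sum)
open import Data.List.Properties using (∷-injectiveʳ; length-take; take++drop≡id)
open import Data.List.Membership.Propositional.Properties using (∈-filter⁺; ∈-filter⁻; ∈-upTo⁺; ∈-upTo⁻)
import Data.List.Relation.Unary.All as All
import Data.List.Relation.Unary.Unique.Propositional.Properties as Unique
open import Data.Nat
open import Data.Nat.Induction using (<-rec; <-wellFounded)
open import Data.Nat.Properties
open import Data.Nat.Tactic.RingSolver using (solve-∀)
open import Data.Product using (∃; ∃-syntax; ∃₂; _×_; _,_; proj₁)
open import Data.Sum using (_⊎_; inj₁; inj₂)
open import Function using (_∘′_)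
open import Induction.WellFounded using (WellFounded; Acc; acc; module Subrelation)
open import Relation.Binary.PropositionalEquality
open import Relation.Nullary using (¬_; Dec; yes; no; contradiction)
open import Relation.Nullary.Decidable using (map′; _×-dec_)

open import Defs

open import Algebra.Properties.Group (AbelianGroup.group ℤ.+-0-abelianGroup) using (∙-cancelˡ)

T[n]≤T[1+n] : ∀ n → T n ≤ T (suc n)
T[n]≤T[1+n] 0 = z≤n
T[n]≤T[1+n] 1 = z≤n
T[n]≤T[1+n] 2 = ≤-refl
T[n]≤T[1+n] (suc (suc (suc n))) = ≤-trans (m≤m+n _ (T (2 + n))) (m≤m+n _ (T (1 + n)))

T-mono-≤ : ∀ {m n} → m ≤ n → T m ≤ T n
T-mono-≤ = mono′ ∘′ ≤⇒≤′
  where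
  mono′ : ∀ {m n} → m ≤′ n → T m ≤ T n
  mono′ ≤′-refl = ≤-refl
  mono′ (≤′-step {n} m≤′n) = ≤-trans (mono′ m≤′n) (T[n]≤T[1+n] n)

0<T[2+n] : ∀ n → 0 < T (2 + n)
0<T[2+n] zero = s≤s z≤n
0<T[2+n] (suc n) = <-≤-trans (0<T[2+n] n) (T[n]≤T[1+n] (2 + n))

n<T[4+n] : ∀ n → n < T (4 + n)
n<T[4+n] zero = s≤s z≤n
n<T[4+n] (suc n) = begin-strict
  suc n                             ≤⟨ n<T[4+n] n ⟩
  T (4 + n)                         <⟨ m<m+n (T (4 + n)) (0<T[2+n] (1 + n)) ⟩
  T (4 + n) + T (3 + n)             ≤⟨ m≤m+n _ (T (2 + n)) ⟩
  T (4 + n) + T (3 + n) + T (2 + n) ∎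
  where open ≤-Reasoning

T[n]+T[n]≤T[3+n] : ∀ n → T n + T n ≤ T (3 + n)
T[n]+T[n]≤T[3+n] n = begin
  T n + T n                   ≤⟨ +-monoˡ-≤ (T n) (T-mono-≤ (m≤n+m n 2)) ⟩
  T (2 + n) + T n             ≤⟨ +-monoˡ-≤ (T n) (m≤m+n (T (2 + n)) (T (1 + n))) ⟩
  T (2 + n) + T (1 + n) + T n ∎
  where open ≤-Reasoning

[1+k]*T[n]≤T[k*3+n] : ∀ k n → suc k * T n ≤ T (k * 3 + n)
[1+k]*T[n]≤T[k*3+n] zero n = ≤-reflexive (+-identityʳ (T n))
[1+k]*T[n]≤T[k*3+n] (suc k) n = begin
  T n + suc k * T n             ≤⟨ +-monoʳ-≤ (T n) ([1+k]*T[n]≤T[k*3+n] k n) ⟩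
  T n + T (k * 3 + n)           ≤⟨ +-monoˡ-≤ _ (T-mono-≤ (m≤n+m n (k * 3))) ⟩
  T (k * 3 + n) + T (k * 3 + n) ≤⟨ T[n]+T[n]≤T[3+n] (k * 3 + n) ⟩
  T (suc k * 3 + n)             ∎
  where open ≤-Reasoning

-- Sequences satisfying the Tribonacci recurrence

module _ {A : Set} (_⊕_ : A → A → A) where

  TribonacciLike : (ℕ → A) → Set
  TribonacciLike P = ∀ j → P (3 + j) ≡ (P (2 + j) ⊕ P (1 + j)) ⊕ P j

  TribonacciLike-unique : ∀ {P Q} → TribonacciLike P → TribonacciLike Q →
                          P 0 ≡ Q 0 → P 1 ≡ Q 1 → P 2 ≡ Q 2 → ∀ j → P j ≡ Q j
  TribonacciLike-unique {P} {Q} rec-P rec-Q e₀ e₁ e₂ j = proj₁ (window j)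
    where
    window : ∀ j → P j ≡ Q j × P (1 + j) ≡ Q (1 + j) × P (2 + j) ≡ Q (2 + j)
    window zero = e₀ , e₁ , e₂
    window (suc j) with window j
    ... | p₀ , p₁ , p₂ = p₁ , p₂ , (begin
      P (3 + j)                     ≡⟨ rec-P j ⟩
      (P (2 + j) ⊕ P (1 + j)) ⊕ P j ≡⟨ cong₂ _⊕_ (cong₂ _⊕_ p₂ p₁) p₀ ⟩
      (Q (2 + j) ⊕ Q (1 + j)) ⊕ Q j ≡⟨ rec-Q j ⟨
      Q (3 + j)                     ∎)
      where open ≡-Reasoning

TribonacciLike-tail-unique : ∀ {G H} → TribonacciLike ℤ._+_ G → TribonacciLike ℤ._+_ H →
                             ∀ m → (∀ j → G (j + m) ≡ H (j + m)) → ∀ j → G j ≡ H j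
TribonacciLike-tail-unique {G} {H} rec-G rec-H zero agree j =
  subst (λ i → G i ≡ H i) (+-identityʳ j) (agree j)
TribonacciLike-tail-unique {G} {H} rec-G rec-H (suc m) agree =
  TribonacciLike-tail-unique rec-G rec-H m (step-back (λ j → rec-G (j + m)) (λ j → rec-H (j + m)) agree′)
  where
  agree′ : ∀ j → G (suc j + m) ≡ H (suc j + m)
  agree′ j = subst (λ i → G i ≡ H i) (+-suc j m) (agree j)

  step-back : ∀ {G H : ℕ → ℤ} → TribonacciLike ℤ._+_ G → TribonacciLike ℤ._+_ H →
              (∀ j → G (suc j) ≡ H (suc j)) → ∀ j → G j ≡ H j
  step-back {G} {H} rec-G rec-H agree zero = ∙-cancelˡ (H 2 ℤ.+ H 1) (G 0) (H 0) (begin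
    (H 2 ℤ.+ H 1) ℤ.+ G 0 ≡⟨ cong₂ (λ a b → (a ℤ.+ b) ℤ.+ G 0) (sym (agree 1)) (sym (agree 0)) ⟩
    (G 2 ℤ.+ G 1) ℤ.+ G 0 ≡⟨ sym (rec-G 0) ⟩
    G 3                   ≡⟨ agree 2 ⟩
    H 3                   ≡⟨ rec-H 0 ⟩
    (H 2 ℤ.+ H 1) ℤ.+ H 0 ∎)
    where open ≡-Reasoning
  step-back rec-G rec-H agree (suc j) = agree j

-- Coefficient lists and their normal forms

-- Most significant coefficient first: at level N the entry at position i
-- weighs T (N - i), so entries deeper than N weigh T 0 = 0.
eval : ℕ → List ℕ → ℕ
eval N [] = 0
eval N (x ∷ c) = x * T N + eval (pred N) c

head₀ : List ℕ → ℕ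
head₀ [] = 0
head₀ (x ∷ _) = x

tail₀ : List ℕ → List ℕ
tail₀ [] = []
tail₀ (_ ∷ c) = c

inc : ℕ → List ℕ → List ℕ
inc zero [] = 1 ∷ []
inc zero (x ∷ c) = suc x ∷ c
inc (suc d) c = head₀ c ∷ inc d (tail₀ c)

eval-inc : ∀ d N c → eval (d + N) (inc d c) ≡ T N + eval (d + N) c
eval-inc zero N [] = cong (_+ 0) (+-identityʳ (T N))
eval-inc zero N (x ∷ c) = +-assoc (T N) (x * T N) (eval (pred N) c)
eval-inc (suc d) N [] = eval-inc d N []
eval-inc (suc d) N (x ∷ c) = begin
  x * T (suc d + N) + eval (d + N) (inc d c)  ≡⟨ cong (_+_ (x * T (suc d + N))) (eval-inc d N c) ⟩
  x * T (suc d + N) + (T N + eval (d + N) c)  ≡⟨ +-comm-middle (x * T (suc d + N)) (T N) (eval (d + N) c) ⟩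
  T N + (x * T (suc d + N) + eval (d + N) c)  ∎
  where
  open ≡-Reasoning
  +-comm-middle : ∀ a b c → a + (b + c) ≡ b + (a + c)
  +-comm-middle = solve-∀

sum-inc : ∀ d c → sum (inc d c) ≡ suc (sum c)
sum-inc zero [] = refl
sum-inc zero (x ∷ c) = refl
sum-inc (suc d) [] = sum-inc d []
sum-inc (suc d) (x ∷ c) = trans (cong (_+_ x) (sum-inc d c)) (+-suc x (sum c))

eval-head : ∀ N c → head₀ c * T N ≤ eval N c
eval-head N [] = z≤n
eval-head N (x ∷ c) = m≤m+n (x * T N) (eval (pred N) c)

eval≤sum*T : ∀ N c → eval N c ≤ sum c * T N
eval≤sum*T N [] = z≤n
eval≤sum*T N (x ∷ c) = begin
  x * T N + eval (pred N) c     ≤⟨ +-monoʳ-≤ (x * T N) (eval≤sum*T (pred N) c) ⟩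
  x * T N + sum c * T (pred N)  ≤⟨ +-monoʳ-≤ (x * T N) (*-monoʳ-≤ (sum c) (T-mono-≤ (pred[n]≤n {N}))) ⟩
  x * T N + sum c * T N         ≡⟨ *-distribʳ-+ (T N) x (sum c) ⟨
  (x + sum c) * T N             ∎
  where open ≤-Reasoning

pad₀ : ℕ → List ℕ → List ℕ
pad₀ D c = replicate D 0 ++ c

eval-pad₀ : ∀ D N c → eval (D + N) (pad₀ D c) ≡ eval N c
eval-pad₀ zero N c = refl
eval-pad₀ (suc D) N c = eval-pad₀ D N c

-- A step at depth d rewrites the entries from position d on: carry uses
-- T p = T (p - 1) + T (p - 2) + T (p - 3) and split uses 2 T p = T (p + 1) + T (p - 3).
data Step : ℕ → List ℕ → List ℕ → Set where
  carry : ∀ {x y z w c} → Step 0 (x ∷ suc y ∷ suc z ∷ suc w ∷ c) (suc x ∷ y ∷ z ∷ w ∷ c)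
  split : ∀ {x y c} → Step 0 (x ∷ suc (suc y) ∷ c) (suc x ∷ y ∷ inc 2 c)
  skip  : ∀ {d x c c′} → Step d c c′ → Step (suc d) (x ∷ c) (x ∷ c′)

eval-Step : ∀ {d c c′} → Step d c c′ → ∀ N → eval (d + 4 + N) c ≡ eval (d + 4 + N) c′
eval-Step (carry {x} {y} {z} {w} {c}) N =
  carry-identity x y z w (T (2 + N)) (T (1 + N)) (T N) (eval N c)
  where
  carry-identity : ∀ x y z w a b t e → let t₃ = a + b + t in
    x * (t₃ + a + b) + (suc y * t₃ + (suc z * a + (suc w * b + e)))
      ≡ suc x * (t₃ + a + b) + (y * t₃ + (z * a + (w * b + e)))
  carry-identity = solve-∀
eval-Step (split {x} {y} {c}) N = begin
  x * T (4 + N) + (suc (suc y) * T (3 + N) + eval (2 + N) c)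
    ≡⟨ split-identity x y (T (2 + N)) (T (1 + N)) (T N) (eval (2 + N) c) ⟩
  suc x * T (4 + N) + (y * T (3 + N) + (T N + eval (2 + N) c))
    ≡⟨ cong (λ e → suc x * T (4 + N) + (y * T (3 + N) + e)) (eval-inc 2 N c) ⟨
  suc x * T (4 + N) + (y * T (3 + N) + eval (2 + N) (inc 2 c))
    ∎
  where
  open ≡-Reasoning
  split-identity : ∀ x y a b t e → let t₃ = a + b + t in
    x * (t₃ + a + b) + (suc (suc y) * t₃ + e) ≡ suc x * (t₃ + a + b) + (y * t₃ + (t + e))
  split-identity = solve-∀
eval-Step (skip {d} {x} step) N = cong (_+_ (x * T (suc d + 4 + N))) (eval-Step step N)

sum-Step : ∀ {d c c′} → Step d c c′ → sum c′ ≤ sum c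
sum-Step (carry {x} {y} {z} {w} {c}) =
  ≤-trans (m≤n+m _ 2) (≤-reflexive (carry-sum x y z w (sum c)))
  where
  carry-sum : ∀ x y z w s → 2 + (suc x + (y + (z + (w + s)))) ≡ x + (suc y + (suc z + (suc w + s)))
  carry-sum = solve-∀
sum-Step (split {x} {y} {c}) = ≤-reflexive (begin
  suc x + (y + sum (inc 2 c)) ≡⟨ cong (λ s → suc x + (y + s)) (sum-inc 2 c) ⟩
  suc x + (y + suc (sum c))   ≡⟨ split-sum x y (sum c) ⟩
  x + (suc (suc y) + sum c)   ∎)
  where
  open ≡-Reasoning
  split-sum : ∀ x y s → suc x + (y + suc s) ≡ x + (suc (suc y) + s)
  split-sum = solve-∀
sum-Step (skip {x = x} step) = +-monoʳ-≤ x (sum-Step step)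

data _≻_ : List ℕ → List ℕ → Set where
  here  : ∀ {c′ c} → head₀ c < head₀ c′ → c′ ≻ c
  there : ∀ {c′ c} → head₀ c′ ≡ head₀ c → tail₀ c′ ≻ tail₀ c → c′ ≻ c

[]⊁ : ∀ {c} → ¬ ([] ≻ c)
[]⊁ (here ())
[]⊁ (there _ []≻) = []⊁ []≻

Step⇒≻ : ∀ {d c c′} → Step d c c′ → c′ ≻ c
Step⇒≻ carry = here ≤-refl
Step⇒≻ split = here ≤-refl
Step⇒≻ (skip step) = there refl (Step⇒≻ step)

BoundedAscent : ℕ → List ℕ → List ℕ → Set
BoundedAscent s c′ c = sum c′ ≤ s × c′ ≻ c

module _ {s} (below : ∀ {s′} → s′ < s → WellFounded (BoundedAscent s′)) where

  private
    acc-∷ : ∀ {h t} → Acc _<_ (s ∸ h) → Acc (BoundedAscent (s ∸ h)) t → Acc (BoundedAscent s) (h ∷ t)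
    ascend : ∀ {h t} → Acc _<_ (s ∸ h) → Acc (BoundedAscent (s ∸ h)) t →
             ∀ {c} → BoundedAscent s c (h ∷ t) → Acc (BoundedAscent s) c

    acc-∷ acc-h acc-t = acc (ascend acc-h acc-t)

    ascend _ _ {[]} (_ , []≻) = ⊥-elim ([]⊁ []≻)
    ascend (acc <h) _ {x ∷ c} (bound , here h<x) =
      acc-∷ (<h (∸-monoʳ-< h<x x≤s)) (below (∸-monoʳ-< (≤-<-trans z≤n h<x) x≤s) c)
      where x≤s = m+n≤o⇒m≤o x bound
    ascend acc-h (acc ≻t) {x ∷ c} (bound , there refl c≻t) =
      acc-∷ acc-h (≻t (m+n≤o⇒m≤o∸n (sum c) (subst (_≤ s) (+-comm x (sum c)) bound) , c≻t))

    acc-≻[] : ∀ {c} → c ≻ [] → sum c ≤ s → Acc (BoundedAscent s) c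
    acc-≻[] {[]} []≻ _ = ⊥-elim ([]⊁ []≻)
    acc-≻[] {x ∷ c} (here 0<x) bound =
      acc-∷ (<-wellFounded (s ∸ x)) (below (∸-monoʳ-< 0<x (m+n≤o⇒m≤o x bound)) c)
    acc-≻[] {x ∷ c} (there refl c≻[]) bound = acc-∷ (<-wellFounded s) (acc-≻[] c≻[] bound)

  wellFounded-step : WellFounded (BoundedAscent s)
  wellFounded-step [] = acc λ (bound , c≻[]) → acc-≻[] c≻[] bound
  wellFounded-step (h ∷ t) =
    acc-∷ (<-wellFounded (s ∸ h)) (Subrelation.accessible shrink (wellFounded-step t))
    where
    shrink : ∀ {c′ c} → BoundedAscent (s ∸ h) c′ c → BoundedAscent s c′ c
    shrink (bound , c′≻c) = ≤-trans bound (m∸n≤m s h) , c′≻c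

BoundedAscent-wellFounded : ∀ s → WellFounded (BoundedAscent s)
BoundedAscent-wellFounded = <-rec (WellFounded ∘′ BoundedAscent) (λ s below → wellFounded-step below)

data Overfull : List ℕ → Set where
  two   : ∀ {x c} → Overfull (suc (suc x) ∷ c)
  three : ∀ {x y z c} → Overfull (suc x ∷ suc y ∷ suc z ∷ c)

data Canonical : List ℕ → Set where
  []  : Canonical []
  _∷_ : ∀ {x c} → ¬ Overfull (x ∷ c) → Canonical c → Canonical (x ∷ c)

overfull? : ∀ c → Dec (Overfull c)
overfull? [] = no λ ()
overfull? (0 ∷ c) = no λ ()
overfull? (1 ∷ []) = no λ ()
overfull? (1 ∷ 0 ∷ c) = no λ ()
overfull? (1 ∷ suc y ∷ []) = no λ ()
overfull? (1 ∷ suc y ∷ 0 ∷ c) = no λ ()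
overfull? (1 ∷ suc y ∷ suc z ∷ c) = yes three
overfull? (suc (suc x) ∷ c) = yes two

Overfull⇒1≤head : ∀ {c} → Overfull c → 1 ≤ head₀ c
Overfull⇒1≤head two = s≤s z≤n
Overfull⇒1≤head three = s≤s z≤n

Reducible : List ℕ → Set
Reducible c = ∃₂ λ d c′ → Step d c c′

classify : ∀ c → Canonical c ⊎ Overfull c ⊎ Reducible c
classify [] = inj₁ []
classify (x ∷ c) with classify c
... | inj₂ (inj₁ two) = inj₂ (inj₂ (0 , _ , split))
... | inj₂ (inj₁ three) = inj₂ (inj₂ (0 , _ , carry))
... | inj₂ (inj₂ (d , c′ , step)) = inj₂ (inj₂ (suc d , x ∷ c′ , skip step))
... | inj₁ can with overfull? (x ∷ c)
...   | yes over = inj₂ (inj₁ over)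
...   | no ¬over = inj₁ (¬over ∷ can)

record EventuallyEqual (c c′ : List ℕ) : Set where
  constructor eventually
  field
    threshold : ℕ
    agree     : ∀ N → threshold ≤ N → eval N c ≡ eval N c′

EventuallyEqual-trans : ∀ {c₁ c₂ c₃} → EventuallyEqual c₁ c₂ → EventuallyEqual c₂ c₃ →
                        EventuallyEqual c₁ c₃
EventuallyEqual-trans (eventually B₁ eq₁) (eventually B₂ eq₂) = eventually (B₁ ⊔ B₂) λ N le →
  trans (eq₁ N (≤-trans (m≤m⊔n B₁ B₂) le)) (eq₂ N (≤-trans (m≤n⊔m B₁ B₂) le))

Step⇒EventuallyEqual : ∀ {d c c′} → Step d c c′ → EventuallyEqual c′ c
Step⇒EventuallyEqual {d} {c} {c′} step = eventually (d + 4) agree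
  where
  agree : ∀ N → d + 4 ≤ N → eval N c′ ≡ eval N c
  agree N le with m≤n⇒∃[o]m+o≡n le
  ... | o , refl = sym (eval-Step step o)

-- Rules out an overfull head, which could only be resolved above position 0.
Small : List ℕ → Set
Small c = ∃[ N₀ ] ∀ N → N₀ ≤ N → eval N c < T N

Small⇒head≡0 : ∀ {c c₀} → Small c₀ → EventuallyEqual c c₀ → head₀ c ≡ 0
Small⇒head≡0 {c} {c₀} (N₀ , small) (eventually B eq) with head₀ c in head≡
... | zero = refl
... | suc h = contradiction (small N (m≤m⊔n N₀ B)) (≤⇒≯ (begin
  T N              ≤⟨ m≤m+n (T N) (h * T N) ⟩
  suc h * T N      ≡⟨ cong (_* T N) head≡ ⟨
  head₀ c * T N    ≤⟨ eval-head N c ⟩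
  eval N c         ≡⟨ eq N (m≤n⊔m N₀ B) ⟩
  eval N c₀        ∎))
  where
  open ≤-Reasoning
  N = N₀ ⊔ B

normalForm : ∀ c₀ → Small c₀ → ∃[ g ] Canonical g × EventuallyEqual g c₀
normalForm c₀ small = normalise c₀ ≤-refl (eventually 0 λ _ _ → refl) (BoundedAscent-wellFounded (sum c₀) c₀)
  where
  normalise : ∀ c → sum c ≤ sum c₀ → EventuallyEqual c c₀ → Acc (BoundedAscent (sum c₀)) c →
              ∃[ g ] Canonical g × EventuallyEqual g c₀
  normalise c bound eq (acc ascend) with classify c
  ... | inj₁ can = c , can , eq
  ... | inj₂ (inj₁ over) =
    contradiction (Small⇒head≡0 small eq) (≢-sym (<⇒≢ (Overfull⇒1≤head over)))
  ... | inj₂ (inj₂ (_ , c′ , step)) =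
    normalise c′ bound′ (EventuallyEqual-trans (Step⇒EventuallyEqual step) eq) (ascend (bound′ , Step⇒≻ step))
    where bound′ = ≤-trans (sum-Step step) bound

pad₀-Small : ∀ c → Small (pad₀ (sum c * 3) c)
pad₀-Small c = sum c * 3 + 2 , small
  where
  small : ∀ N → sum c * 3 + 2 ≤ N → eval N (pad₀ (sum c * 3) c) < T N
  small N le with m≤n⇒∃[o]m+o≡n le
  ... | o , refl rewrite +-assoc (sum c * 3) 2 o = begin-strict
    eval (sum c * 3 + (2 + o)) (pad₀ (sum c * 3) c) ≡⟨ eval-pad₀ (sum c * 3) (2 + o) c ⟩
    eval (2 + o) c                                  ≤⟨ eval≤sum*T (2 + o) c ⟩
    sum c * T (2 + o)                               <⟨ m<n+m _ (0<T[2+n] o) ⟩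
    suc (sum c) * T (2 + o)                         ≤⟨ [1+k]*T[n]≤T[k*3+n] (sum c) (2 + o) ⟩
    T (sum c * 3 + (2 + o))                         ∎
    where open ≤-Reasoning

bit : ℕ → Bool
bit zero = false
bit (suc _) = true

-- Reverses c onto ds: digit lists are least significant first.
toDigits : List ℕ → List Bool → List Bool
toDigits [] ds = ds
toDigits (x ∷ c) ds = toDigits c (bit x ∷ ds)

digit-bit : ∀ {x c} → ¬ Overfull (x ∷ c) → ∀ t → digit (bit x) t ≡ x * t
digit-bit {zero} _ t = refl
digit-bit {suc zero} _ t = sym (+-identityʳ t)
digit-bit {suc (suc x)} ¬over t = contradiction two ¬over

valFrom-toDigits : ∀ {c} → Canonical c → ∀ s ds →
                   valFrom (suc s) (toDigits c ds) ≡ eval (length c + s) c + valFrom (suc (length c + s)) ds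
valFrom-toDigits [] s ds = refl
valFrom-toDigits {x ∷ c} (¬over ∷ can) s ds = begin
  valFrom (suc s) (toDigits c (bit x ∷ ds))
    ≡⟨ valFrom-toDigits can s (bit x ∷ ds) ⟩
  eval L c + (digit (bit x) (T (suc L)) + valFrom (2 + L) ds)
    ≡⟨ cong (λ d → eval L c + (d + valFrom (2 + L) ds)) (digit-bit ¬over (T (suc L))) ⟩
  eval L c + (x * T (suc L) + valFrom (2 + L) ds)
    ≡⟨ +-comm-front (eval L c) (x * T (suc L)) (valFrom (2 + L) ds) ⟩
  x * T (suc L) + eval L c + valFrom (2 + L) ds
    ∎
  where
  open ≡-Reasoning
  L = length c + s
  +-comm-front : ∀ a b e → a + (b + e) ≡ b + a + e
  +-comm-front = solve-∀

-- The windows of toDigits c ds that contain the last bit of ds and the first entry of c.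
Straddle : List Bool → List ℕ → Set
Straddle ds c = (∀ {r} → ds ≡ true ∷ true ∷ r → ¬ Overfull (1 ∷ 1 ∷ c))
               × (∀ {r} → ds ≡ true ∷ r → ¬ Overfull (1 ∷ c))

raise-second : ∀ {x c} → Overfull (1 ∷ 1 ∷ c) → Overfull (1 ∷ suc x ∷ c)
raise-second three = three

raise-first : ∀ {x c} → Overfull (1 ∷ c) → Overfull (suc x ∷ c)
raise-first three = three

NoThree-toDigits : ∀ {c ds} → Canonical c → NoThree ds → Straddle ds c → NoThree (toDigits c ds)
NoThree-toDigits [] nt _ = nt
NoThree-toDigits {zero ∷ c} (_ ∷ can) nt _ =
  NoThree-toDigits can (nt-cons nt λ _ → refl) ((λ ()) , (λ ()))
NoThree-toDigits {suc x ∷ c} (¬over ∷ can) nt (two-before , one-before) =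
  NoThree-toDigits can (nt-cons nt λ eq → contradiction three (two-before eq))
    ( (λ eq → one-before (∷-injectiveʳ eq) ∘′ raise-second)
    , (λ _ → ¬over ∘′ raise-first))

pad : ℕ → List Bool → List Bool
pad m ds = replicate m false ++ ds

valFrom-pad : ∀ m s ds → valFrom s (pad m ds) ≡ valFrom (s + m) ds
valFrom-pad zero s ds = cong (λ i → valFrom i ds) (sym (+-identityʳ s))
valFrom-pad (suc m) s ds = trans (valFrom-pad m (suc s) ds) (cong (λ i → valFrom i ds) (sym (+-suc s m)))

NoThree-pad : ∀ m {ds} → NoThree ds → NoThree (pad m ds)
NoThree-pad zero nt = nt
NoThree-pad (suc m) nt = nt-cons (NoThree-pad m nt) (λ _ → refl)

NoThree-++⁻ˡ : ∀ xs {ys} → NoThree (xs ++ ys) → NoThree xs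
NoThree-++⁻ˡ [] _ = nt-nil
NoThree-++⁻ˡ (x ∷ xs) (nt-cons nt guard) = nt-cons (NoThree-++⁻ˡ xs nt) (λ eq → guard (cong (_++ _) eq))

NoThree-++⁻ʳ : ∀ xs {ys} → NoThree (xs ++ ys) → NoThree ys
NoThree-++⁻ʳ [] nt = nt
NoThree-++⁻ʳ (x ∷ xs) (nt-cons nt _) = NoThree-++⁻ʳ xs nt

valFrom-recurrence : ∀ s ds → valFrom (3 + s) ds ≡ valFrom (2 + s) ds + valFrom (1 + s) ds + valFrom s ds
valFrom-recurrence s [] = refl
valFrom-recurrence s (d ∷ ds) = begin
  digit d (T (3 + s)) + valFrom (4 + s) ds
    ≡⟨ cong₂ _+_ (digit-recurrence d) (valFrom-recurrence (suc s) ds) ⟩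
  (digit d (T (2 + s)) + digit d (T (1 + s)) + digit d (T s)) + (valFrom (3 + s) ds + valFrom (2 + s) ds + valFrom (1 + s) ds)
    ≡⟨ interchange (digit d (T (2 + s))) (digit d (T (1 + s))) (digit d (T s)) _ _ _ ⟩
  (digit d (T (2 + s)) + valFrom (3 + s) ds) + (digit d (T (1 + s)) + valFrom (2 + s) ds) + (digit d (T s) + valFrom (1 + s) ds)
    ∎
  where
  open ≡-Reasoning
  digit-recurrence : ∀ d → digit d (T (3 + s)) ≡ digit d (T (2 + s)) + digit d (T (1 + s)) + digit d (T s)
  digit-recurrence true = refl
  digit-recurrence false = refl
  interchange : ∀ a b c x y z → a + b + c + (x + y + z) ≡ a + x + (b + y) + (c + z)
  interchange = solve-∀

leading-zeros : ∀ s ds → 0 < valFrom s ds → ∃₂ λ m h → ds ≡ pad m (true ∷ h)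
leading-zeros s (true ∷ ds) _ = 0 , ds , refl
leading-zeros s (false ∷ ds) pos with leading-zeros (suc s) ds pos
... | m , h , refl = suc m , h , refl

-- Tails of extraTribs

TwoSidedTribonacci : (ℤ → ℤ) → Set
TwoSidedTribonacci S = ∀ i → S i ≡ S (i ℤ.- 1ℤ) ℤ.+ S (i ℤ.- + 2) ℤ.+ S (i ℤ.- + 3)

TwoSidedTribonacci⇒TribonacciLike : ∀ {S} → TwoSidedTribonacci S → ∀ k → TribonacciLike ℤ._+_ (λ j → S (k ℤ.+ + j))
TwoSidedTribonacci⇒TribonacciLike {S} rec k j = begin
  S (k ℤ.+ + (3 + j))
    ≡⟨ rec _ ⟩
  S (k ℤ.+ + (3 + j) ℤ.- 1ℤ) ℤ.+ S (k ℤ.+ + (3 + j) ℤ.- + 2) ℤ.+ S (k ℤ.+ + (3 + j) ℤ.- + 3)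
    ≡⟨ cong₂ ℤ._+_ (cong₂ ℤ._+_ (reassoc _) (reassoc _)) (reassoc _) ⟩
  S (k ℤ.+ + (2 + j)) ℤ.+ S (k ℤ.+ + (1 + j)) ℤ.+ S (k ℤ.+ + j)
    ∎
  where
  open ≡-Reasoning
  reassoc : ∀ i → S (k ℤ.+ + (3 + j) ℤ.+ i) ≡ S (k ℤ.+ (+ (3 + j) ℤ.+ i))
  reassoc i = cong S (ℤ.+-assoc k (+ (3 + j)) i)

-- From index k on, S runs through the value of ds and of its shifts, i.e. its images under out.
Orbit : (ℤ → ℤ) → ℤ → List Bool → Set
Orbit S k ds = ∀ j → S (k ℤ.+ + j) ≡ + valFrom (3 + j) ds

Orbit-unpad : ∀ {S k m ds} → TwoSidedTribonacci S → Orbit S k (pad m ds) → Orbit S (k ℤ.- + m) ds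
Orbit-unpad {S} {k} {m} {ds} rec orbit =
  TribonacciLike-tail-unique (TwoSidedTribonacci⇒TribonacciLike rec (k ℤ.- + m))
    (λ j → cong +_ (valFrom-recurrence (3 + j) ds)) m agree
  where
  shift-back : ∀ k a b → k ℤ.- b ℤ.+ (a ℤ.+ b) ≡ k ℤ.+ a
  shift-back = ℤ-Solver.solve-∀
  agree : ∀ j → S (k ℤ.- + m ℤ.+ + (j + m)) ≡ + valFrom (3 + (j + m)) ds
  agree j = begin
    S (k ℤ.- + m ℤ.+ + (j + m)) ≡⟨ cong S (shift-back k (+ j) (+ m)) ⟩
    S (k ℤ.+ + j)               ≡⟨ orbit j ⟩
    + valFrom (3 + j) (pad m ds) ≡⟨ cong +_ (valFrom-pad m (3 + j) ds) ⟩
    + valFrom (3 + j + m) ds     ∎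
    where open ≡-Reasoning

trib : ℕ → ℕ → ℕ → ℕ → ℕ
trib a b c 0 = a
trib a b c 1 = b
trib a b c 2 = c
trib a b c (suc (suc (suc n))) = trib a b c (suc (suc n)) + trib a b c (suc n) + trib a b c n

TribonacciLike⇒trib : ∀ {G} → TribonacciLike ℤ._+_ G → (∀ n → 0ℤ ℤ.≤ G n) →
                      ∀ n → G n ≡ + trib ℤ.∣ G 0 ∣ ℤ.∣ G 1 ∣ ℤ.∣ G 2 ∣ n
TribonacciLike⇒trib {G} rec nonneg = TribonacciLike-unique ℤ._+_ rec (λ _ → refl) (abs 0) (abs 1) (abs 2)
  where
  abs : ∀ n → G n ≡ + ℤ.∣ G n ∣
  abs n = sym (ℤ.0≤i⇒+∣i∣≡i (nonneg n))

-- Coefficients found by solving for trib a b c 5, 6 and 7.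
trib≡eval : ∀ a b c n → trib a b c (5 + n) ≡ eval (5 + n) (c ∷ a + b ∷ b ∷ [])
trib≡eval a b c = TribonacciLike-unique _+_ (λ _ → refl) rec-eval
  (base₅ a b c) (base₆ a b c) (base₇ a b c)
  where
  rec-eval : TribonacciLike _+_ (λ n → eval (5 + n) (c ∷ a + b ∷ b ∷ []))
  rec-eval j = shifted c (a + b) b (T (3 + j)) (T (4 + j)) (T (5 + j))
    where
    shifted : ∀ c ab b t₃ t₄ t₅ → let t₆ = t₅ + t₄ + t₃; t₇ = t₆ + t₅ + t₄; t₈ = t₇ + t₆ + t₅ in
      c * t₈ + (ab * t₇ + (b * t₆ + 0))
        ≡ c * t₇ + (ab * t₆ + (b * t₅ + 0)) + (c * t₆ + (ab * t₅ + (b * t₄ + 0))) + (c * t₅ + (ab * t₄ + (b * t₃ + 0)))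
    shifted = solve-∀
  base₅ : ∀ a b c → let v₃ = c + b + a; v₄ = v₃ + c + b in
    v₄ + v₃ + c ≡ c * 4 + ((a + b) * 2 + (b * 1 + 0))
  base₅ = solve-∀
  base₆ : ∀ a b c → let v₃ = c + b + a; v₄ = v₃ + c + b; v₅ = v₄ + v₃ + c in
    v₅ + v₄ + v₃ ≡ c * 7 + ((a + b) * 4 + (b * 2 + 0))
  base₆ = solve-∀
  base₇ : ∀ a b c → let v₃ = c + b + a; v₄ = v₃ + c + b; v₅ = v₄ + v₃ + c; v₆ = v₅ + v₄ + v₃ in
    v₆ + v₅ + v₄ ≡ c * 13 + ((a + b) * 7 + (b * 4 + 0))
  base₇ = solve-∀

eventually-digits : ∀ m l → ∃₂ λ ds q → NoThree ds × ∀ j → eval (m + (q + j)) l ≡ valFrom (3 + j) ds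
eventually-digits m l with normalForm (pad₀ (sum l * 3) l) (pad₀-Small l)
... | g , can , eventually B agree =
  pad p bs , 2 + L + B , NoThree-pad p (NoThree-toDigits can nt-nil ((λ ()) , (λ ()))) , digits
  where
  D = sum l * 3
  L = length g
  bs = toDigits g []
  p = D + m + B
  digits : ∀ j → eval (m + (2 + L + B + j)) l ≡ valFrom (3 + j) (pad p bs)
  digits j = begin
    eval (m + (2 + L + B + j)) l              ≡⟨ eval-pad₀ D _ l ⟨
    eval (D + (m + (2 + L + B + j))) (pad₀ D l) ≡⟨ agree _ B≤ ⟨
    eval (D + (m + (2 + L + B + j))) g        ≡⟨ cong (λ N → eval N g) (reindex D m L B j) ⟩
    eval (L + (2 + j + p)) g                  ≡⟨ +-identityʳ _ ⟨
    eval (L + (2 + j + p)) g + 0              ≡⟨ valFrom-toDigits can (2 + j + p) [] ⟨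
    valFrom (3 + j + p) bs                    ≡⟨ valFrom-pad p (3 + j) bs ⟨
    valFrom (3 + j) (pad p bs)                ∎
    where
    open ≡-Reasoning
    reindex : ∀ D m L B j → D + (m + (2 + L + B + j)) ≡ L + (2 + j + (D + m + B))
    reindex = solve-∀
    B≤ : B ≤ D + (m + (2 + L + B + j))
    B≤ = ≤-trans (m≤n+m B (2 + L)) (≤-trans (m≤m+n _ j) (≤-trans (m≤n+m _ m) (m≤n+m _ D)))

Orbit-leading : ∀ {S k ds} → TwoSidedTribonacci S → NoThree ds → Orbit S k ds → 0 < valFrom 3 ds →
                ∃₂ λ k′ h → NoThree (true ∷ h) × Orbit S k′ (true ∷ h)
Orbit-leading {S} {k} {ds} rec nt orbit pos with leading-zeros 3 ds pos
... | m , h , refl =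
  k ℤ.- + m , h , NoThree-++⁻ʳ (replicate m false) nt , Orbit-unpad {S} {k} {m} rec orbit

trib-orbit : ∀ {S K a b c} → (∀ n → S (K ℤ.+ + n) ≡ + trib a b c n) →
             ∃₂ λ ds q → NoThree ds × Orbit S (K ℤ.+ + (5 + q)) ds
trib-orbit {S} {K} {a} {b} {c} tail =
  let ds , q , nt , digits = eventually-digits 5 (c ∷ a + b ∷ b ∷ [])
  in ds , q , nt , λ j → begin
    S (K ℤ.+ + (5 + q) ℤ.+ + j)               ≡⟨ cong S (ℤ.+-assoc K (+ (5 + q)) (+ j)) ⟩
    S (K ℤ.+ + (5 + (q + j)))                 ≡⟨ tail (5 + (q + j)) ⟩
    + trib a b c (5 + (q + j))                ≡⟨ cong +_ (trib≡eval a b c (q + j)) ⟩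
    + eval (5 + (q + j)) (c ∷ a + b ∷ b ∷ []) ≡⟨ cong +_ (digits j) ⟩
    + valFrom (3 + j) ds                      ∎
  where open ≡-Reasoning

extraTrib-orbit : ∀ {S} → IsExtraTrib S → ∃₂ λ k h → NoThree (true ∷ h) × Orbit S k (true ∷ h)
extraTrib-orbit {S} (rec , i₀ , pos) =
  let ds , q , nt , orbit = trib-orbit {S} {i₀} tail
      k₀ = i₀ ℤ.+ + (5 + q)
      0<S[k₀] = pos (k₀ ℤ.+ + 0) (ℤ.≤-trans (ℤ.i≤i+j i₀ (+ (5 + q))) (ℤ.i≤i+j k₀ (+ 0)))
  in Orbit-leading {S} {k₀} {ds} rec nt orbit (ℤ.drop‿+<+ (subst (0ℤ ℤ.<_) (orbit 0) 0<S[k₀]))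
  where
  v : ℕ → ℕ
  v n = ℤ.∣ S (i₀ ℤ.+ + n) ∣
  tail : ∀ n → S (i₀ ℤ.+ + n) ≡ + trib (v 0) (v 1) (v 2) n
  tail = TribonacciLike⇒trib (TwoSidedTribonacci⇒TribonacciLike rec i₀)
           (λ n → ℤ.<⇒≤ (pos _ (ℤ.i≤i+j i₀ (+ n))))

-- Rows of the Trithoff array

noThree? : ∀ ds → Dec (NoThree ds)
noThree? [] = yes nt-nil
noThree? (d ∷ ds) with noThree? ds
... | no ¬nt = no λ { (nt-cons nt _) → ¬nt nt }
... | yes nt = map′ (nt-cons nt) (λ { (nt-cons _ guard) → guard }) (guard? d ds)
  where
  guard? : ∀ d ds → Dec (∀ {ds′} → ds ≡ true ∷ true ∷ ds′ → d ≡ false)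
  guard? false _ = yes λ _ → refl
  guard? true [] = yes λ ()
  guard? true (false ∷ _) = yes λ ()
  guard? true (true ∷ []) = yes λ ()
  guard? true (true ∷ false ∷ _) = yes λ ()
  guard? true (true ∷ true ∷ _) = no λ guard → contradiction (guard refl) λ ()

search-bits : ∀ {P : List Bool → Set} → (∀ ds → Dec (P ds)) → ∀ n → Dec (∃[ ds ] length ds ≤ n × P ds)
search-bits P? zero = map′ (λ p → [] , z≤n , p) (λ { ([] , _ , p) → p }) (P? [])
search-bits P? (suc n)
  with P? [] | search-bits (λ ds → P? (true ∷ ds)) n | search-bits (λ ds → P? (false ∷ ds)) n
... | yes p | _ | _ = yes ([] , z≤n , p)
... | no _ | yes (ds , le , p) | _ = yes (true ∷ ds , s≤s le , p)
... | no _ | no _ | yes (ds , le , p) = yes (false ∷ ds , s≤s le , p)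
... | no ¬p | no ¬t | no ¬f = no λ
  { ([] , _ , p) → ¬p p
  ; (true ∷ ds , s≤s le , p) → ¬t (ds , le , p)
  ; (false ∷ ds , s≤s le , p) → ¬f (ds , le , p) }

valFrom-take-drop : ∀ s k ds → valFrom s (take k ds) + valFrom (s + k) (drop k ds) ≡ valFrom s ds
valFrom-take-drop s zero ds = cong (λ i → valFrom i ds) (+-identityʳ s)
valFrom-take-drop s (suc k) [] = refl
valFrom-take-drop s (suc k) (d ∷ ds) = begin
  first + valFrom (suc s) (take k ds) + valFrom (s + suc k) (drop k ds)   ≡⟨ +-assoc first _ _ ⟩
  first + (valFrom (suc s) (take k ds) + valFrom (s + suc k) (drop k ds))
    ≡⟨ cong (λ i → first + (valFrom (suc s) (take k ds) + valFrom i (drop k ds))) (+-suc s k) ⟩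
  first + (valFrom (suc s) (take k ds) + valFrom (suc s + k) (drop k ds))
    ≡⟨ cong (_+_ first) (valFrom-take-drop (suc s) k ds) ⟩
  first + valFrom (suc s) ds                                               ∎
  where
  open ≡-Reasoning
  first = digit d (T s)

valFrom≡0⊎T≤valFrom : ∀ s ds → valFrom s ds ≡ 0 ⊎ T s ≤ valFrom s ds
valFrom≡0⊎T≤valFrom s [] = inj₁ refl
valFrom≡0⊎T≤valFrom s (true ∷ ds) = inj₂ (m≤m+n (T s) (valFrom (suc s) ds))
valFrom≡0⊎T≤valFrom s (false ∷ ds) with valFrom≡0⊎T≤valFrom (suc s) ds
... | inj₁ ≡0 = inj₁ ≡0
... | inj₂ T≤ = inj₂ (≤-trans (T[n]≤T[1+n] s) T≤)

-- Digits beyond position N would already weigh more than N.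
D0One⇒short : ∀ N → D0One N → ∃[ ds ] length ds ≤ N × CanonRep (true ∷ ds) N
D0One⇒short N (ds , nt , value) =
  take N ds , length-take≤ , NoThree-++⁻ˡ (true ∷ take N ds) nt′ , trans (cong suc take-value) value
  where
  length-take≤ : length (take N ds) ≤ N
  length-take≤ = ≤-trans (≤-reflexive (length-take N ds)) (m⊓n≤m N (length ds))
  nt′ : NoThree ((true ∷ take N ds) ++ drop N ds)
  nt′ = subst (λ xs → NoThree (true ∷ xs)) (sym (take++drop≡id N ds)) nt
  drop-value : valFrom (4 + N) (drop N ds) ≡ 0
  drop-value with valFrom≡0⊎T≤valFrom (4 + N) (drop N ds)
  ... | inj₁ ≡0 = ≡0
  ... | inj₂ T≤ = contradiction (begin-strict
    N                                                   <⟨ n<T[4+n] N ⟩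
    T (4 + N)                                           ≤⟨ T≤ ⟩
    valFrom (4 + N) (drop N ds)                         ≤⟨ m≤n+m _ (valFrom 4 (take N ds)) ⟩
    valFrom 4 (take N ds) + valFrom (4 + N) (drop N ds) ≡⟨ valFrom-take-drop 4 N ds ⟩
    valFrom 4 ds                                        <⟨ ≤-reflexive value ⟩
    N                                                   ∎) (<-irrefl refl)
    where open ≤-Reasoning
  take-value : valFrom 4 (take N ds) ≡ valFrom 4 ds
  take-value = begin
    valFrom 4 (take N ds)                               ≡⟨ +-identityʳ _ ⟨
    valFrom 4 (take N ds) + 0                           ≡⟨ cong (_+_ (valFrom 4 (take N ds))) drop-value ⟨
    valFrom 4 (take N ds) + valFrom (4 + N) (drop N ds) ≡⟨ valFrom-take-drop 4 N ds ⟩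
    valFrom 4 ds                                        ∎
    where open ≡-Reasoning

D0One? : ∀ N → Dec (D0One N)
D0One? N = map′ (λ (ds , _ , rep) → ds , rep) (D0One⇒short N)
  (search-bits (λ ds → noThree? (true ∷ ds) ×-dec (valFrom 3 (true ∷ ds) ≟ N)) N)

Leading : ℕ → Set
Leading m = 0 < m × D0One m

leading? : ∀ m → Dec (Leading m)
leading? m = (0 <? m) ×-dec D0One? m

rank : ℕ → ℕ
rank N = suc (length (filter leading? (upTo N)))

FirstCol-rank : ∀ {N} → Leading N → FirstCol (rank N) N
FirstCol-rank {N} (0<N , d₀) =
  s≤s z≤n , 0<N , d₀ , filter leading? (upTo N) , refl , Unique.filter⁺ leading? (Unique.upTo⁺ N)
  , All.tabulate (λ m∈ → let m∈upTo , 0<m , d₀-m = ∈-filter⁻ leading? {xs = upTo N} m∈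
                         in 0<m , ∈-upTo⁻ m∈upTo , d₀-m)
  , λ m 0<m m<N d₀-m → ∈-filter⁺ leading? (∈-upTo⁺ m<N) (0<m , d₀-m)

Out-valFrom : ∀ {ds} → NoThree ds → ∀ j → Out (valFrom (3 + j) ds) (valFrom (4 + j) ds)
Out-valFrom {ds} nt j = pad j ds , (NoThree-pad j nt , valFrom-pad j 3 ds) , valFrom-pad j 4 ds

Trithoff-row : ∀ {h} → NoThree (true ∷ h) →
               ∀ j → Trithoff (rank (valFrom 3 (true ∷ h))) (suc j) (valFrom (3 + j) (true ∷ h))
Trithoff-row {h} nt zero = col1 (FirstCol-rank (s≤s z≤n , h , nt , refl))
Trithoff-row nt (suc j) = colS (Trithoff-row nt j) (Out-valFrom nt j)

mainTheorem16 : (S : ℤ → ℤ) → IsExtraTrib S →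
    ∃ λ (k : ℤ) → ∃ λ (r : ℕ) → (j : ℕ) →
      ∃ λ (N : ℕ) → S (k ℤ.+ + j) ≡ + N × Trithoff r (suc j) N
mainTheorem16 S extra =
  let k , h , nt , orbit = extraTrib-orbit extra
  in k , rank (valFrom 3 (true ∷ h)) , λ j → valFrom (3 + j) (true ∷ h) , orbit j , Trithoff-row nt j
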